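{- Let $\mathcal{P}_0=\{(2,3)\}$ and, for $k\ge 0$, let $\mathcal{P}_{k+1}$ be obtained from $\mathcal{P}_k$ by replacing each pair $(c,V)\in\mathcal{P}_k$ by the two pairs $\left(\tfrac{3c_1}{2},\,3V\right)$ and $\left(\tfrac{3c_2+1}{4},\,3V\right)$, where $c_1$ is the least even element of $\{c+Vj: j\in\mathbb{N}_0\}$ and $c_2$ is the least element of $\{c+Vj: j\in\mathbb{N}_0\}$ that is congruent to $1 \pmod 4$. Then for every $k\ge 0$ and every $(c,V)\in\mathcal{P}_k$ one has $c<V$.
   Context: $\mathbb{N}=\{1,2,3,\dots\}$ and $\mathbb{N}_0=\{0\}\cup\mathbb{N}$. The map $F_l:\{2+2m: m\in\mathbb{N}_0\}\cup\{1+4m: m\in\mathbb{N}_0\}\to\mathbb{N}$ is defined by $F_l(2+2m)=3+3m$ and $F_l(1+4m)=1+3m$, i.e. $F_l(x)=3x/2$ for even $x$ and $F_l(x)=(3x+1)/4$ for $x\equiv 1\pmod 4$. Set $A_0=\{2+3m: m\in\mathbb{N}_0\}$ and $A_{k+1}=F_l(A_k)$ (image of the elements of $A_k$ lying in the domain of $F_l$). For each $k$, every pair $(c,V)\in\mathcal{P}_k$ has $V=3^{k+1}$ (odd), so $c_1,c_2$ exist; the arithmetic progressions $\{c+Vj: j\in\mathbb{N}_0\}$, $(c,V)\in\mathcal{P}_k$, are the "$z$-proportional subsets" of $A_k$, with intercept $c$ and interval $V$. Each pair in $\mathcal{P}_{k+1}$ is the (intercept, interval) of the image under $F_l$ of the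 even elements, respectively the elements $\equiv 1 \pmod 4$, of a progression in $\mathcal{P}_k$. -}

module Defs where

open import Data.Nat using (ℕ; zero; suc; _+_; _*_; _≤_; _<_)
open import Data.Nat.DivMod using (_/_; _%_)
open import Data.Nat.Divisibility using (_∣_)
open import Data.Product using (∃; _×_)
open import Relation.Binary.PropositionalEquality using (_≡_)

InProg : ℕ → ℕ → ℕ → Set
InProg c V x = ∃ λ j → x ≡ c + V * j

IsLeastIn : (ℕ → Set) → ℕ → ℕ → ℕ → Set
IsLeastIn P c V x = InProg c V x × P x × (∀ y → InProg c V y → P y → x ≤ y)

Even : ℕ → Set
Even x = 2 ∣ x

OneMod4 : ℕ → Set
OneMod4 x = x % 4 ≡ 1

data InP : ℕ → ℕ → ℕ → Set where
  base : InP 0 2 3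
  step₁ : ∀ {k c V c₁} → InP k c V → IsLeastIn Even c V c₁ →
          InP (suc k) ((3 * c₁) / 2) (3 * V)
  step₂ : ∀ {k c V c₂} → InP k c V → IsLeastIn OneMod4 c V c₂ →
          InP (suc k) ((3 * c₂ + 1) / 4) (3 * V)

{-# OPTIONS --safe #-}
module Submission where

-- Every interval V in 𝒫ₖ is odd (it is 3^(k+1)).  An odd step V runs through all residues
-- mod 2 within two steps and all residues mod 4 within four, so if c < V then
-- c₁ < 2V and c₂ < 4V.  Hence 3c₁/2 < 3V and (3c₂+1)/4 < 3V, and the invariant
-- "c < V with V odd" passes from 𝒫ₖ to 𝒫ₖ₊₁.

open import Defs
open import Data.Nat using (ℕ; suc; _+_; _*_; _≤_; _<_; _/_; _%_; NonZero; z≤n; s≤s)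
open import Data.Nat.Properties
open import Data.Nat.DivMod using (m≡m%n+[m/n]*n; [m+kn]%n≡m%n; m%n<n; %-distribˡ-*; m∣n⇒o%n%m≡o%m; m<n*o⇒m/o<n)
open import Data.Nat.Divisibility using (m%n≡0⇒n∣m; divides)
open import Data.Nat.Tactic.RingSolver using (solve-∀)
open import Data.Product using (∃; _×_; _,_; proj₁)
open import Relation.Binary.PropositionalEquality using (_≡_; refl; trans; cong; cong₂; module ≡-Reasoning)

Odd : ℕ → Set
Odd n = n % 2 ≡ 1

*-odd : ∀ m n → Odd m → Odd n → Odd (m * n)
*-odd m n odd-m odd-n = begin
  (m * n) % 2              ≡⟨ %-distribˡ-* m n 2 ⟩
  ((m % 2) * (n % 2)) % 2  ≡⟨ cong₂ (λ a b → (a * b) % 2) odd-m odd-n ⟩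
  1                        ∎
  where open ≡-Reasoning

progression-mod : ∀ c V j n .{{_ : NonZero n}} →
                  (c + V * j) % n ≡ (c % n + V % n * j) % n
progression-mod c V j n = begin
  (c + V * j) % n
    ≡⟨ cong₂ (λ c′ V′ → (c′ + V′ * j) % n) (m≡m%n+[m/n]*n c n) (m≡m%n+[m/n]*n V n) ⟩
  ((c % n + c / n * n) + (V % n + V / n * n) * j) % n
    ≡⟨ cong (_% n) (regroup (c % n) (c / n) (V % n) (V / n) j n) ⟩
  (c % n + V % n * j + (c / n + V / n * j) * n) % n
    ≡⟨ [m+kn]%n≡m%n (c % n + V % n * j) (c / n + V / n * j) n ⟩
  (c % n + V % n * j) % n
    ∎
  where
  open ≡-Reasoning
  regroup : ∀ r q s t j n → (r + q * n) + (s + t * n) * j ≡ r + s * j + (q + t * j) * n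
  regroup = solve-∀

odd-step-hits-0-mod-2 : ∀ r → r < 2 → ∃ λ j → j < 2 × (r + 1 * j) % 2 ≡ 0
odd-step-hits-0-mod-2 0 _ = 0 , s≤s z≤n , refl
odd-step-hits-0-mod-2 1 _ = 1 , s≤s (s≤s z≤n) , refl
odd-step-hits-0-mod-2 (suc (suc _)) (s≤s (s≤s ()))

odd-step-hits-1-mod-4 : ∀ r v → r < 4 → v < 4 → Odd v → ∃ λ j → j < 4 × (r + v * j) % 4 ≡ 1
odd-step-hits-1-mod-4 0 1 _ _ _ = 1 , s≤s (s≤s z≤n) , refl
odd-step-hits-1-mod-4 1 1 _ _ _ = 0 , s≤s z≤n , refl
odd-step-hits-1-mod-4 2 1 _ _ _ = 3 , ≤-refl , refl
odd-step-hits-1-mod-4 3 1 _ _ _ = 2 , s≤s (s≤s (s≤s z≤n)) , refl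
odd-step-hits-1-mod-4 0 3 _ _ _ = 3 , ≤-refl , refl
odd-step-hits-1-mod-4 1 3 _ _ _ = 0 , s≤s z≤n , refl
odd-step-hits-1-mod-4 2 3 _ _ _ = 1 , s≤s (s≤s z≤n) , refl
odd-step-hits-1-mod-4 3 3 _ _ _ = 2 , s≤s (s≤s (s≤s z≤n)) , refl
odd-step-hits-1-mod-4 (suc (suc (suc (suc _)))) _ (s≤s (s≤s (s≤s (s≤s ())))) _ _
odd-step-hits-1-mod-4 _ (suc (suc (suc (suc _)))) _ (s≤s (s≤s (s≤s (s≤s ())))) _

even-in-odd-progression : ∀ c V → Odd V → ∃ λ j → j < 2 × Even (c + V * j)
even-in-odd-progression c V odd-V with odd-step-hits-0-mod-2 (c % 2) (m%n<n c 2)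
... | j , j<2 , even = j , j<2 , m%n≡0⇒n∣m _ 2 (begin
  (c + V * j) % 2          ≡⟨ progression-mod c V j 2 ⟩
  (c % 2 + V % 2 * j) % 2  ≡⟨ cong (λ v → (c % 2 + v * j) % 2) odd-V ⟩
  (c % 2 + 1 * j) % 2      ≡⟨ even ⟩
  0                        ∎)
  where open ≡-Reasoning

oneMod4-in-odd-progression : ∀ c V → Odd V → ∃ λ j → j < 4 × OneMod4 (c + V * j)
oneMod4-in-odd-progression c V odd-V
  with odd-step-hits-1-mod-4 (c % 4) (V % 4) (m%n<n c 4) (m%n<n V 4)
                       (trans (m∣n⇒o%n%m≡o%m 2 4 V (divides 2 refl)) odd-V)
... | j , j<4 , oneMod4 = j , j<4 , trans (progression-mod c V j 4) oneMod4

least-below : ∀ {P c V x j n} → IsLeastIn P c V x → c < V → j < n → P (c + V * j) →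
              x < V * n
least-below {c = c} {V} {x} {j} {n} (_ , _ , least) c<V j<n p = begin-strict
  x          ≤⟨ least (c + V * j) (j , refl) p ⟩
  c + V * j  <⟨ +-monoˡ-< (V * j) c<V ⟩
  V + V * j  ≡⟨ *-suc V j ⟨
  V * suc j  ≤⟨ *-monoʳ-≤ V j<n ⟩
  V * n      ∎
  where open ≤-Reasoning

image-below : ∀ {x} y V n .{{_ : NonZero n}} → y ≤ 3 * x + 2 → x < V * n → y / n < 3 * V
image-below {x} y V n y≤ x<Vn = m<n*o⇒m/o<n (begin-strict
  y            ≤⟨ y≤ ⟩
  3 * x + 2    <⟨ +-monoʳ-< (3 * x) (n<1+n 2) ⟩
  3 * x + 3    ≡⟨ +-comm (3 * x) 3 ⟩
  3 + 3 * x    ≡⟨ *-suc 3 x ⟨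
  3 * suc x    ≤⟨ *-monoʳ-≤ 3 x<Vn ⟩
  3 * (V * n)  ≡⟨ *-assoc 3 V n ⟨
  3 * V * n    ∎)
  where open ≤-Reasoning

Invariant : ℕ → ℕ → Set
Invariant c V = c < V × Odd V

step₁-preserves : ∀ {c V c₁} → IsLeastIn Even c V c₁ → Invariant c V →
                  Invariant ((3 * c₁) / 2) (3 * V)
step₁-preserves {c} {V} {c₁} least (c<V , odd-V) =
  let j , j<2 , even = even-in-odd-progression c V odd-V
  in image-below (3 * c₁) V 2 (m≤m+n (3 * c₁) 2) (least-below least c<V j<2 even)
   , *-odd 3 V refl odd-V

step₂-preserves : ∀ {c V c₂} → IsLeastIn OneMod4 c V c₂ → Invariant c V →
                  Invariant ((3 * c₂ + 1) / 4) (3 * V)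
step₂-preserves {c} {V} {c₂} least (c<V , odd-V) =
  let j , j<4 , oneMod4 = oneMod4-in-odd-progression c V odd-V
  in image-below (3 * c₂ + 1) V 4 (+-monoʳ-≤ (3 * c₂) (s≤s z≤n))
                 (least-below least c<V j<4 oneMod4)
   , *-odd 3 V refl odd-V

invariant : ∀ {k c V} → InP k c V → Invariant c V
invariant base = s≤s (s≤s (s≤s z≤n)) , refl
invariant (step₁ p least) = step₁-preserves least (invariant p)
invariant (step₂ p least) = step₂-preserves least (invariant p)

lemma2 : ∀ (k c V : ℕ) → InP k c V → c < V
lemma2 k c V p = proj₁ (invariant p)
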